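{- Let $\mathbf{A}$ be a finite relational structure, all of whose relations have arity at most $d$, for some integer $d\geq 2$. If $\mathbf{A}$ is $|A|^d$-polymorphism-homogeneous, then it is polymorphism-homogeneous.
   Context: For a relational structure $\mathbf{A}$ over a relational signature $L$ and $k\geq1$, $\mathbf{A}^k$ is the direct power (carrier $A^k$, relations defined coordinatewise). A $k$-ary polymorphism of $\mathbf{A}$ is a homomorphism $\mathbf{A}^k\to\mathbf{A}$; a $k$-ary local polymorphism is a homomorphism from a finite induced substructure of $\mathbf{A}^k$ to $\mathbf{A}$. $\mathbf{A}$ is $k$-polymorphism-homogeneous if every $k$-ary local polymorphism extends to a $k$-ary polymorphism, and polymorphism-homogeneous if it is $k$-polymorphism-homogeneous for every $k\geq1$. -}

module Defs where

open import Data.Nat using (ℕ; _≤_; _^_)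
open import Data.Fin using (Fin)
open import Data.Bool using (Bool; true)
open import Data.Vec using (Vec; map; lookup)
open import Data.List using (List)
open import Data.List.Membership.Propositional using (_∈_)
open import Data.Vec.Relation.Unary.All using (All)
open import Data.Product using (Σ; _×_)
open import Relation.Binary.PropositionalEquality using (_≡_)

-- A finite relational structure: signature (index set I, arities ar),
-- carrier Fin size (so |A| = size), and for each symbol i a relation on
-- A^(ar i), given by its (decidable) characteristic function.
record Structure : Set₁ where
  field
    I    : Set
    ar   : I → ℕ
    size : ℕ
    R    : (i : I) → Vec (Fin size) (ar i) → Bool

module _ (𝔸 : Structure) where
  open Structure 𝔸

  Pow : ℕ → Set
  Pow k = Vec (Fin size) k

  PowRel : (k : ℕ) (i : I) → Vec (Pow k) (ar i) → Set
  PowRel k i t = (j : Fin k) → R i (map (λ x → lookup x j) t) ≡ true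

  -- f restricted to the finite induced substructure of A^k with carrier B
  -- is a homomorphism into A (values of f outside B are irrelevant).
  IsLocalPolymorphism : (k : ℕ) → List (Pow k) → (Pow k → Fin size) → Set
  IsLocalPolymorphism k B f =
    (i : I) (t : Vec (Pow k) (ar i)) → All (_∈ B) t →
    PowRel k i t → R i (map f t) ≡ true

  IsPolymorphism : (k : ℕ) → (Pow k → Fin size) → Set
  IsPolymorphism k g =
    (i : I) (t : Vec (Pow k) (ar i)) → PowRel k i t → R i (map g t) ≡ true

  KPolymorphismHomogeneous : ℕ → Set
  KPolymorphismHomogeneous k =
    (B : List (Pow k)) (f : Pow k → Fin size) → IsLocalPolymorphism k B f →
    Σ (Pow k → Fin size) λ g →
      IsPolymorphism k g × ((x : Pow k) → x ∈ B → g x ≡ f x)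

  PolymorphismHomogeneous : Set
  PolymorphismHomogeneous = (k : ℕ) → 1 ≤ k → KPolymorphismHomogeneous k

-- An arity-d signature and |A|^d-homogeneity first give a near-unanimity
-- polymorphism of arity d + 1: the partial operation that returns the majority
-- value on near-unanimous (d+1)-tuples is a local polymorphism, because a
-- relation of arity at most d sees at most d positions, so some coordinate
-- avoids every exceptional position, and it extends by homogeneity.
-- Next, a local polymorphism defined on at most d points has at most |A|^d
-- distinct columns, so it factors through A^(|A|^d) and extends as well.
-- Finally, the Baker–Pixley argument: given more than d points, extend the
-- local polymorphism with each of d + 1 of them removed and combine the d + 1
-- extensions with the near-unanimity operation; every point is missed by at
-- most one of them.

module Submission where

open import Defs
open import Data.Nat using (ℕ; _≤_; _^_)
open import Data.Nat.Base using (zero; suc; _<_; z≤n; s≤s; z<s)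
open import Data.Nat.Properties
  using (_≤?_; ≤-trans; ≤-pred; <⇒≱; ≰⇒>; +-mono-≤; m≤m+n; m^n>0;
         ^-monoˡ-≤; ^-monoʳ-≤)
open import Data.Fin using (Fin; zero; suc; inject≤; _≟_; funToFin; finToFun)
open import Data.Fin.Properties
  using (any?; all?; ¬∀⟶∃¬; injective⇒≤; inject≤-injective; nonZeroIndex;
         finToFun-funToFin)
open import Data.Fin.Base using (punchOut)
open import Data.Vec
  using (Vec; []; _∷_; lookup; tabulate; map; replicate; _[_]≔_; removeAt; toList; fromList)
open import Data.Vec.Properties
  using (lookup∘tabulate; lookup-map; map-∘; map-cong; lookup-replicate;
         lookup∘update; lookup∘update′; removeAt-punchOut; toList∘fromList)
open import Data.Vec.Relation.Binary.Pointwise.Extensional using (ext; Pointwise-≡⇒≡)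
import Data.Vec.Relation.Unary.Any as VecAny
open import Data.Vec.Relation.Unary.Any.Properties using (toList⁻; lookup-index)
import Data.Vec.Membership.Propositional.Properties as VecMembership
import Data.Vec.Relation.Unary.All as All
open import Data.Vec.Relation.Unary.All.Properties using (lookup⁺; map⁺)
open import Data.List as List using (List; allFin; cartesianProduct)
open import Data.List.Membership.Propositional using (_∈_)
open import Data.List.Membership.Propositional.Properties
  using (∈-map⁺; ∈-map⁻; ∈-cartesianProduct⁺; ∈-allFin)
open import Data.List.Relation.Binary.Subset.Propositional using (_⊆_)
open import Data.List.Relation.Unary.Any using (here; there)
open import Data.Product using (Σ; ∃; _×_; _,_; proj₁; proj₂)
import Data.Product as Product
open import Data.Bool using (true)
open import Function using (_∘_)
open import Function.Definitions using (Injective)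
open import Relation.Nullary using (yes; no; ¬?; contradiction)
open import Relation.Nullary.Decidable using (decidable-stable)
open import Relation.Binary.PropositionalEquality
  using (_≡_; _≢_; refl; sym; trans; cong; subst; module ≡-Reasoning)

Fin-irrelevant : ∀ {n} → n ≤ 1 → (a b : Fin n) → a ≡ b
Fin-irrelevant {suc zero}    _        zero zero = refl
Fin-irrelevant {suc (suc _)} (s≤s ()) _    _

∃-∉-image : ∀ {m n} → m < n → (p : Fin m → Fin n) → ∃ λ l → ∀ x → p x ≢ l
∃-∉-image {m} m<n p with any? (λ l → all? (λ x → ¬? (p x ≟ l)))
... | yes avoided = avoided
... | no ¬avoided = contradiction (injective⇒≤ preimage-injective) (<⇒≱ m<n)
  where
  preimage : ∀ l → ∃ λ x → p x ≡ l
  preimage l = Product.map₂ (λ {x} → decidable-stable (p x ≟ l))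
    (¬∀⟶∃¬ m _ (λ x → ¬? (p x ≟ l)) (λ avoids → ¬avoided (l , avoids)))

  preimage-injective : Injective _≡_ _≡_ (proj₁ ∘ preimage)
  preimage-injective {l} {l′} eq =
    trans (sym (proj₂ (preimage l))) (trans (cong p eq) (proj₂ (preimage l′)))

injective⇒hitsAtMostOnce : ∀ {m n} {ι : Fin (suc m) → Fin n} → Injective _≡_ _≡_ ι →
  ∀ j → ∃ λ i → ∀ l → l ≢ i → ι l ≢ j
injective⇒hitsAtMostOnce {ι = ι} ι-injective j with any? (λ i → ι i ≟ j)
... | yes (i , ιi≡j) = i , λ l l≢i ιl≡j → l≢i (ι-injective (trans ιl≡j (sym ιi≡j)))
... | no ¬hit        = zero , λ l _ ιl≡j → ¬hit (l , ιl≡j)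

n<2^n : ∀ n → n < 2 ^ n
n<2^n zero    = z<s
n<2^n (suc n) = +-mono-≤ (m^n>0 2 n) (≤-trans (n<2^n n) (m≤m+n (2 ^ n) 0))

module _ {A : Set} where

  ∈-toList⇒lookup : ∀ {n} {xs : Vec A n} {y} → y ∈ toList xs → ∃ λ p → y ≡ lookup xs p
  ∈-toList⇒lookup y∈ = VecAny.index (toList⁻ y∈) , lookup-index (toList⁻ y∈)

  toList-removeAt-⊆ : ∀ {n} (xs : Vec A (suc n)) i → toList (removeAt xs i) ⊆ toList xs
  toList-removeAt-⊆ (x ∷ xs)     zero    y∈         = there y∈
  toList-removeAt-⊆ (x ∷ y ∷ xs) (suc i) (here eq)  = here eq
  toList-removeAt-⊆ (x ∷ y ∷ xs) (suc i) (there y∈) =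
    there (toList-removeAt-⊆ (y ∷ xs) i y∈)

  lookup-∈-toList-removeAt : ∀ {n} (xs : Vec A (suc n)) {i j} → i ≢ j →
    lookup xs j ∈ toList (removeAt xs i)
  lookup-∈-toList-removeAt xs {i} i≢j = subst (_∈ toList (removeAt xs i))
    (removeAt-punchOut xs i≢j)
    (VecMembership.∈-toList⁺ (VecMembership.∈-lookup (punchOut i≢j) (removeAt xs i)))

  NearUnanimous : ∀ {n} → Vec A n → A → Fin n → Set
  NearUnanimous v a i = ∀ l → l ≢ i → lookup v l ≡ a

  IsNearUnanimity : ∀ {n} → (Vec A n → A) → Set
  IsNearUnanimity {n} m = ∀ (v : Vec A n) a i → NearUnanimous v a i → m v ≡ a

  nearUnanimous-η : ∀ {n} {v : Vec A n} {a i} → NearUnanimous v a i →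
    v ≡ replicate n a [ i ]≔ lookup v i
  nearUnanimous-η {v = v} {a} {i} v≈a = Pointwise-≡⇒≡ (ext pointwise)
    where
    pointwise : ∀ l → lookup v l ≡ lookup (replicate _ a [ i ]≔ lookup v i) l
    pointwise l with l ≟ i
    ... | yes refl = sym (lookup∘update l (replicate _ a) (lookup v l))
    ... | no l≢i   = trans (v≈a l l≢i)
      (sym (trans (lookup∘update′ l≢i (replicate _ a) (lookup v i)) (lookup-replicate l a)))

  replicate-update-nearUnanimous : ∀ {n} a i b → NearUnanimous (replicate n a [ i ]≔ b) a i
  replicate-update-nearUnanimous a i b l l≢i =
    trans (lookup∘update′ l≢i (replicate _ a) b) (lookup-replicate l a)

module _ {s : ℕ} where

  nearUnanimousTuples : ∀ n → List (Vec (Fin s) n)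
  nearUnanimousTuples n = List.map (λ { (a , i , b) → replicate n a [ i ]≔ b })
    (cartesianProduct (allFin s) (cartesianProduct (allFin n) (allFin s)))

  ∈-nearUnanimousTuples⁺ : ∀ {n} {v : Vec (Fin s) n} {a i} → NearUnanimous v a i →
    v ∈ nearUnanimousTuples n
  ∈-nearUnanimousTuples⁺ {v = v} {a} {i} v≈a = subst (_∈ nearUnanimousTuples _)
    (sym (nearUnanimous-η v≈a))
    (∈-map⁺ _ (∈-cartesianProduct⁺ (∈-allFin a)
                (∈-cartesianProduct⁺ (∈-allFin i) (∈-allFin (lookup v i)))))

  ∈-nearUnanimousTuples⁻ : ∀ {n} {v : Vec (Fin s) n} → v ∈ nearUnanimousTuples n →
    ∃ λ a → ∃ λ i → NearUnanimous v a i
  ∈-nearUnanimousTuples⁻ v∈ with ∈-map⁻ _ v∈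
  ... | (a , i , b) , _ , refl = a , i , replicate-update-nearUnanimous a i b

  -- At most one of the first three entries of a near-unanimous tuple is
  -- exceptional.
  majorityOfFirstThree : ∀ {n} → Vec (Fin s) (suc (suc (suc n))) → Fin s
  majorityOfFirstThree (x ∷ y ∷ z ∷ _) with x ≟ y
  ... | yes _ = x
  ... | no _  = z

  majorityOfFirstThree-isNearUnanimity : ∀ {n} →
    IsNearUnanimity (majorityOfFirstThree {n})
  majorityOfFirstThree-isNearUnanimity (x ∷ y ∷ z ∷ _) a i v≈a with x ≟ y
  ... | yes x≡y with i ≟ zero
  ...   | yes refl = trans x≡y (v≈a (suc zero) λ ())
  ...   | no i≢0   = v≈a zero (i≢0 ∘ sym)
  majorityOfFirstThree-isNearUnanimity (x ∷ y ∷ z ∷ _) a i v≈a | no x≢y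
    with i ≟ suc (suc zero)
  ... | yes refl = contradiction (trans (v≈a zero λ ()) (sym (v≈a (suc zero) λ ()))) x≢y
  ... | no i≢2   = v≈a (suc (suc zero)) (i≢2 ∘ sym)

module _ (𝔸 : Structure) where
  open Structure 𝔸

  Extends : (k : ℕ) → List (Pow 𝔸 k) → (Pow 𝔸 k → Fin size) → Set
  Extends k L f = Σ (Pow 𝔸 k → Fin size) λ g →
    IsPolymorphism 𝔸 k g × ((x : Pow 𝔸 k) → x ∈ L → g x ≡ f x)

  IsLocalPolymorphism-⊆ : ∀ {k L L′ f} → L ⊆ L′ →
    IsLocalPolymorphism 𝔸 k L′ f → IsLocalPolymorphism 𝔸 k L f
  IsLocalPolymorphism-⊆ L⊆L′ f-local i t t∈L = f-local i t (All.map L⊆L′ t∈L)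

  lookup-isPolymorphism : ∀ {k} (j : Fin k) → IsPolymorphism 𝔸 k (λ x → lookup x j)
  lookup-isPolymorphism j i t rel = rel j

  tuple : ∀ {k m} → (Fin m → Pow 𝔸 k → Fin size) → Pow 𝔸 k → Pow 𝔸 m
  tuple hs x = tabulate (λ p → hs p x)

  tuple-preservesPowRel : ∀ {k m} {hs : Fin m → Pow 𝔸 k → Fin size} →
    (∀ p → IsPolymorphism 𝔸 k (hs p)) →
    ∀ i {t} → PowRel 𝔸 k i t → PowRel 𝔸 m i (map (tuple hs) t)
  tuple-preservesPowRel {hs = hs} hs-poly i {t} rel p =
    subst (λ z → R i z ≡ true) column (hs-poly p i t rel)
    where
    column : map (hs p) t ≡ map (λ y → lookup y p) (map (tuple hs) t)
    column = trans (map-cong (λ x → sym (lookup∘tabulate (λ q → hs q x) p)) t)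
                   (map-∘ (λ y → lookup y p) (tuple hs) t)

  ∘tuple-isPolymorphism :
    ∀ {k m} {g : Pow 𝔸 m → Fin size} {hs : Fin m → Pow 𝔸 k → Fin size} →
    IsPolymorphism 𝔸 m g → (∀ p → IsPolymorphism 𝔸 k (hs p)) →
    IsPolymorphism 𝔸 k (g ∘ tuple hs)
  ∘tuple-isPolymorphism {g = g} {hs} g-poly hs-poly i t rel =
    subst (λ z → R i z ≡ true) (sym (map-∘ g (tuple hs) t))
      (g-poly i (map (tuple hs) t) (tuple-preservesPowRel hs-poly i rel))

  reindex : ∀ {k m} → (Fin m → Fin k) → Pow 𝔸 k → Pow 𝔸 m
  reindex σ = tuple (λ p x → lookup x (σ p))

  reindex-preservesPowRel : ∀ {k m} (σ : Fin m → Fin k) →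
    ∀ i {t} → PowRel 𝔸 k i t → PowRel 𝔸 m i (map (reindex σ) t)
  reindex-preservesPowRel σ = tuple-preservesPowRel (lookup-isPolymorphism ∘ σ)

  -- If the points of L identify all coordinates that τ identifies, they are
  -- reindexings of points of A^n; the local polymorphism is transported there
  -- and its extension is pulled back.
  extend-viaReindexing : ∀ {n k L f} → KPolymorphismHomogeneous 𝔸 n →
    (τ : Fin (suc k) → Fin n) →
    (∀ x → x ∈ L → ∀ j j′ → τ j ≡ τ j′ → lookup x j ≡ lookup x j′) →
    IsLocalPolymorphism 𝔸 (suc k) L f → Extends (suc k) L f
  extend-viaReindexing {n} {k} {L} {f} homogeneous τ τ-respects f-local =
    g ∘ reindex ν , ∘tuple-isPolymorphism g-poly (lookup-isPolymorphism ∘ ν) , agrees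
    where
    ν : Fin n → Fin (suc k)
    ν e with any? (λ j → τ j ≟ e)
    ... | yes (j , _) = j
    ... | no _        = zero

    τ∘ν∘τ : ∀ j → τ (ν (τ j)) ≡ τ j
    τ∘ν∘τ j with any? (λ j′ → τ j′ ≟ τ j)
    ... | yes (_ , eq) = eq
    ... | no ¬hit      = contradiction (j , refl) ¬hit

    reindex-τ∘ν : ∀ x → x ∈ L → reindex τ (reindex ν x) ≡ x
    reindex-τ∘ν x x∈L = Pointwise-≡⇒≡ (ext λ j → begin
      lookup (reindex τ (reindex ν x)) j
        ≡⟨ lookup∘tabulate (λ p → lookup (reindex ν x) (τ p)) j ⟩
      lookup (reindex ν x) (τ j)
        ≡⟨ lookup∘tabulate (λ p → lookup x (ν p)) (τ j) ⟩
      lookup x (ν (τ j))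
        ≡⟨ τ-respects x x∈L _ j (τ∘ν∘τ j) ⟩
      lookup x j
        ∎)
      where open ≡-Reasoning

    reindex-τ-∈ : ∀ {y} → y ∈ List.map (reindex ν) L → reindex τ y ∈ L
    reindex-τ-∈ y∈ with ∈-map⁻ (reindex ν) y∈
    ... | x , x∈L , refl = subst (_∈ L) (sym (reindex-τ∘ν x x∈L)) x∈L

    transported-local : IsLocalPolymorphism 𝔸 n (List.map (reindex ν) L) (f ∘ reindex τ)
    transported-local i t t∈ rel =
      subst (λ z → R i z ≡ true) (sym (map-∘ f (reindex τ) t))
        (f-local i (map (reindex τ) t) (map⁺ (All.map reindex-τ-∈ t∈))
                 (reindex-preservesPowRel τ i rel))

    extension = homogeneous (List.map (reindex ν) L) (f ∘ reindex τ) transported-local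
    g = proj₁ extension
    g-poly = proj₁ (proj₂ extension)

    agrees : ∀ x → x ∈ L → g (reindex ν x) ≡ f x
    agrees x x∈L = trans (proj₂ (proj₂ extension) _ (∈-map⁺ (reindex ν) x∈L))
                         (cong f (reindex-τ∘ν x x∈L))

  KPolymorphismHomogeneous-≤ : ∀ {m n} → KPolymorphismHomogeneous 𝔸 n → suc m ≤ n →
    KPolymorphismHomogeneous 𝔸 (suc m)
  KPolymorphismHomogeneous-≤ homogeneous m<n L f =
    extend-viaReindexing homogeneous (λ j → inject≤ j m<n)
      (λ x _ j j′ eq → cong (lookup x) (inject≤-injective m<n m<n j j′ eq))

  -- The columns of n ≤ e points are elements of A^n, encoded in Fin (|A|^n).
  extend-small : ∀ {e k n f} → KPolymorphismHomogeneous 𝔸 (size ^ e) →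
    (xs : Vec (Pow 𝔸 (suc k)) n) → n ≤ e →
    IsLocalPolymorphism 𝔸 (suc k) (toList xs) f → Extends (suc k) (toList xs) f
  extend-small homogeneous [] _ _ =
    (λ x → lookup x zero) , lookup-isPolymorphism zero , λ _ ()
  extend-small {e} {k} {n} homogeneous xs@(x ∷ _) n≤e =
    extend-viaReindexing homogeneous τ τ-respects
    where
    instance
      size-nonZero = nonZeroIndex (lookup x zero)

    column : Fin (suc k) → Fin n → Fin size
    column j p = lookup (lookup xs p) j

    τ : Fin (suc k) → Fin (size ^ e)
    τ j = inject≤ (funToFin (column j)) (^-monoʳ-≤ size n≤e)

    τ-respects : ∀ y → y ∈ toList xs → ∀ j j′ → τ j ≡ τ j′ → lookup y j ≡ lookup y j′
    τ-respects y y∈ j j′ eq with ∈-toList⇒lookup y∈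
    ... | p , refl = begin
      column j p                         ≡⟨ sym (finToFun-funToFin (column j) p) ⟩
      finToFun (funToFin (column j)) p   ≡⟨ cong (λ c → finToFun c p) codes-equal ⟩
      finToFun (funToFin (column j′)) p  ≡⟨ finToFun-funToFin (column j′) p ⟩
      column j′ p                        ∎
      where
      open ≡-Reasoning
      codes-equal : funToFin (column j) ≡ funToFin (column j′)
      codes-equal = inject≤-injective _ _ _ _ eq

  -- A relational tuple has fewer entries than there are coordinates, so some
  -- coordinate l avoids all exceptional positions and the operation is the
  -- l-th projection on it.
  majorityOfFirstThree-isLocalPolymorphism : ∀ {n} → (∀ i → ar i ≤ suc (suc n)) →
    IsLocalPolymorphism 𝔸 (suc (suc (suc n))) (nearUnanimousTuples _) majorityOfFirstThree
  majorityOfFirstThree-isLocalPolymorphism ar≤ i t t∈ rel =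
    subst (λ z → R i z ≡ true) (sym (Pointwise-≡⇒≡ (ext majority≡column))) (rel l)
    where
    exceptional : Fin (ar i) → Fin _
    exceptional q = proj₁ (proj₂ (∈-nearUnanimousTuples⁻ (lookup⁺ t∈ q)))

    l = proj₁ (∃-∉-image (s≤s (ar≤ i)) exceptional)
    l-avoids = proj₂ (∃-∉-image (s≤s (ar≤ i)) exceptional)

    majority≡column : ∀ q → lookup (map majorityOfFirstThree t) q ≡
                            lookup (map (λ x → lookup x l) t) q
    majority≡column q with ∈-nearUnanimousTuples⁻ (lookup⁺ t∈ q) | l-avoids q
    ... | a , _ , tq≈a | l≢i = begin
      lookup (map majorityOfFirstThree t) q  ≡⟨ lookup-map q _ t ⟩
      majorityOfFirstThree (lookup t q)
        ≡⟨ majorityOfFirstThree-isNearUnanimity (lookup t q) a _ tq≈a ⟩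
      a                                      ≡⟨ sym (tq≈a l (l≢i ∘ sym)) ⟩
      lookup (lookup t q) l                  ≡⟨ sym (lookup-map q _ t) ⟩
      lookup (map (λ x → lookup x l) t) q    ∎
      where open ≡-Reasoning

  nearUnanimity-exists : ∀ {n} → (∀ i → ar i ≤ suc (suc n)) →
    KPolymorphismHomogeneous 𝔸 (suc (suc (suc n))) →
    Σ (Pow 𝔸 (suc (suc (suc n))) → Fin size) λ m → IsPolymorphism 𝔸 _ m × IsNearUnanimity m
  nearUnanimity-exists ar≤ homogeneous =
    g , g-poly , λ v a i v≈a → trans (agrees v (∈-nearUnanimousTuples⁺ v≈a))
                                     (majorityOfFirstThree-isNearUnanimity v a i v≈a)
    where
    extension = homogeneous _ _ (majorityOfFirstThree-isLocalPolymorphism ar≤)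
    g = proj₁ extension
    g-poly = proj₁ (proj₂ extension)
    agrees = proj₂ (proj₂ extension)

  -- Point y of xs lies in every list xs minus (ι l) except possibly one, so the
  -- extensions for those lists agree with f at y in all but one argument.
  extend-byNearUnanimity-step : ∀ {e k n f} {m : Pow 𝔸 (suc e) → Fin size} →
    IsPolymorphism 𝔸 (suc e) m → IsNearUnanimity m →
    (xs : Vec (Pow 𝔸 k) (suc n)) {ι : Fin (suc e) → Fin (suc n)} → Injective _≡_ _≡_ ι →
    (∀ l → Extends k (toList (removeAt xs (ι l))) f) → Extends k (toList xs) f
  extend-byNearUnanimity-step {f = f} {m} m-poly m-nu xs {ι} ι-injective extensions =
    m ∘ tuple gs , ∘tuple-isPolymorphism m-poly (proj₁ ∘ proj₂ ∘ extensions) , agrees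
    where
    gs = proj₁ ∘ extensions

    agrees : ∀ y → y ∈ toList xs → m (tuple gs y) ≡ f y
    agrees y y∈ with ∈-toList⇒lookup y∈
    ... | p , refl with injective⇒hitsAtMostOnce ι-injective p
    ... | i , missesOnlyAt-i = m-nu (tuple gs y) (f y) i λ l l≢i →
      trans (lookup∘tabulate (λ l′ → gs l′ y) l)
            (proj₂ (proj₂ (extensions l)) y
              (lookup-∈-toList-removeAt xs (missesOnlyAt-i l l≢i)))

  extend-byNearUnanimity : ∀ {e k f} {m : Pow 𝔸 (suc e) → Fin size} →
    IsPolymorphism 𝔸 (suc e) m → IsNearUnanimity m →
    (∀ {n} (xs : Vec (Pow 𝔸 k) n) → n ≤ e →
      IsLocalPolymorphism 𝔸 k (toList xs) f → Extends k (toList xs) f) →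
    ∀ {n} (xs : Vec (Pow 𝔸 k) n) →
      IsLocalPolymorphism 𝔸 k (toList xs) f → Extends k (toList xs) f
  extend-byNearUnanimity {e} m-poly m-nu extend-few {n} xs f-local with n ≤? e
  ... | yes n≤e = extend-few xs n≤e f-local
  extend-byNearUnanimity m-poly m-nu extend-few {zero} [] f-local | no 0≰e =
    contradiction z≤n 0≰e
  extend-byNearUnanimity {e} m-poly m-nu extend-few {suc n} xs f-local | no n≰e =
    extend-byNearUnanimity-step m-poly m-nu xs (inject≤-injective e<n e<n _ _) λ l →
      extend-byNearUnanimity m-poly m-nu extend-few (removeAt xs (inject≤ l e<n))
        (IsLocalPolymorphism-⊆ (toList-removeAt-⊆ xs _) f-local)
    where
    e<n = ≰⇒> n≰e

  nearUnanimity-of-homogeneous : ∀ {d} → 2 ≤ d → (∀ i → ar i ≤ d) →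
    KPolymorphismHomogeneous 𝔸 (size ^ d) →
    Σ (Pow 𝔸 (suc d) → Fin size) λ m → IsPolymorphism 𝔸 (suc d) m × IsNearUnanimity m
  nearUnanimity-of-homogeneous {suc (suc d)} _ ar≤d homogeneous with 2 ≤? size
  ... | yes 2≤size = nearUnanimity-exists ar≤d (KPolymorphismHomogeneous-≤ homogeneous d<size^d)
    where
    d<size^d : suc (suc (suc d)) ≤ size ^ suc (suc d)
    d<size^d = ≤-trans (n<2^n (suc (suc d))) (^-monoˡ-≤ (suc (suc d)) 2≤size)
  ... | no 2≰size = (λ v → lookup v zero) , lookup-isPolymorphism zero ,
    λ _ _ _ _ → Fin-irrelevant (≤-pred (≰⇒> 2≰size)) _ _
  nearUnanimity-of-homogeneous {suc zero} (s≤s ())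

mainTheorem5 : (𝔸 : Structure) (d : ℕ) → 2 ≤ d →
    ((i : Structure.I 𝔸) → Structure.ar 𝔸 i ≤ d) →
    KPolymorphismHomogeneous 𝔸 (Structure.size 𝔸 ^ d) →
    PolymorphismHomogeneous 𝔸
mainTheorem5 𝔸 d 2≤d ar≤d homogeneous (suc k) _ B f =
  subst (λ L → IsLocalPolymorphism 𝔸 (suc k) L f → Extends 𝔸 (suc k) L f)
    (toList∘fromList B)
    (extend-byNearUnanimity 𝔸 m-poly m-nu (extend-small 𝔸 homogeneous) (fromList B))
  where
  nu = nearUnanimity-of-homogeneous 𝔸 2≤d ar≤d homogeneous
  m-poly = proj₁ (proj₂ nu)
  m-nu = proj₂ (proj₂ nu)
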